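{- Let $(p_k)_{k\ge1}$ be an unbounded, weakly increasing sequence of positive integers. In the flashcard game with insertion sequence $(p_k)$, for every $n\ge1$ we have $T_1(n+1)\le 1+n\cdot p_n$.
   Context: Let $(p_k)_{k\ge1}$ be a sequence of positive integers (the insertion sequence). The flashcard game with insertion sequence $(p_k)$ is the following deterministic process. The state at each time $t=1,2,\dots$ consists of an ordering (the deck) of all positive integers (cards), positions numbered $1,2,\dots$ from the front, together with a counter for each card recording how many times it has been seen. At time $t=1$ the deck is $1,2,3,\dots$, card $1$ (at the front) has been seen once, and all other cards $0$ times. To pass from time $t$ to $t+1$: if the front card has been seen $k$ times so far, remove it and reinsert it so that it occupies position $p_k$; then the card now at the front has its counter increased by one (it is seen at time $t+1$). For $n,k\ge1$, $T_n(k)$ denotes the time at which card $n$ is seen for the $k$-th time. -}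

module Defs where

open import Data.Nat using (ℕ; zero; suc; _+_; _*_; _≤_; _<_; _<ᵇ_; _≡ᵇ_)
open import Data.Bool using (if_then_else_)
open import Data.Product using (_×_)
open import Data.Empty using (⊥)
open import Relation.Binary.PropositionalEquality using (_≡_)

-- Insertion sequence: p k for k ≥ 1 (the value p 0 is irrelevant and never used).
-- Cards are the positive integers 1,2,3,…  Deck positions are stored 0-indexed:
-- deck i is the card at (paper) position i+1.
record State : Set where
  field
    deck : ℕ → ℕ
    seen : ℕ → ℕ      -- card ↦ number of times seen so far

open State public

initial : State
initial = record
  { deck = λ i → suc i
  ; seen = λ c → if c ≡ᵇ 1 then 1 else 0 }

-- one move: front card c, seen k times, is reinserted at position p k
-- (1-indexed), then the new front card has its counter increased.
step : (ℕ → ℕ) → State → State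
step p s = record { deck = d' ; seen = seen' }
  where
  c : ℕ
  c = deck s 0
  q : ℕ
  q = p (seen s c)
  d' : ℕ → ℕ
  d' i = if suc i <ᵇ q then deck s (suc i)
         else if suc i ≡ᵇ q then c
         else deck s i
  seen' : ℕ → ℕ
  seen' x = if x ≡ᵇ d' 0 then suc (seen s x) else seen s x

-- stateAt p m is the state at time m+1
stateAt : (ℕ → ℕ) → ℕ → State
stateAt p zero = initial
stateAt p (suc m) = step p (stateAt p m)

-- card n is seen for the k-th time at time t (t ≥ 1), i.e. T_n(k) = t
IsT : (ℕ → ℕ) → ℕ → ℕ → ℕ → Set
IsT p n k zero = ⊥
IsT p n k (suc m) = deck (stateAt p m) 0 ≡ n × seen (stateAt p m) n ≡ k

module Submission where

-- Card 1 always leads: no card has been seen more often than card 1, the cards strictly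
-- between the front and card 1 (all other cards, when card 1 is at the front) have been
-- seen strictly fewer times, and card 1 lies within the first p_k positions, k being its
-- count. The last clause is what stops a front card tied with card 1 from being
-- reinserted ahead of it.
-- Hence, while card 1 has been seen at most n times, every reinserted card lands among
-- the first p_n positions, so the cards beyond them never move and only the cards
-- 1, …, p_n are ever seen. At time t these carry t views in total, each at most n, so
-- t ≤ n p_n: card 1 is seen for the (n+1)-st time by time 1 + n p_n.

open import Data.Bool using (true; false; if_then_else_)
open import Data.Empty using (⊥-elim)
open import Data.Nat using (ℕ; zero; suc; pred; >-nonZero; _+_; _*_; _≤_; _<_; _<ᵇ_; _≡ᵇ_; z≤n; s≤s; z<s; s<s)
open import Data.Nat.Properties
open import Data.Product using (Σ; _×_; _,_; proj₁; proj₂)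
open import Data.Sum using (_⊎_; inj₁; inj₂; fromInj₁)
open import Data.Unit using (tt)
open import Function.Definitions using (Injective)
open import Relation.Binary using (tri<; tri≈; tri>)
open import Relation.Binary.PropositionalEquality
open import Relation.Nullary using (yes; no)
open import Defs

front : State → ℕ
front s = deck s 0

reinsert : ℕ → ℕ → ℕ
reinsert q i = if suc i <ᵇ q then suc i else if suc i ≡ᵇ q then 0 else i

reinsert⁻¹ : ℕ → ℕ → ℕ
reinsert⁻¹ q zero = pred q
reinsert⁻¹ q (suc k) = if suc k <ᵇ q then k else suc k

deck-step : ∀ p s i → deck (step p s) i ≡ deck s (reinsert (p (seen s (front s))) i)
deck-step p s i with suc i <ᵇ p (seen s (front s))
... | true = refl
... | false with suc i ≡ᵇ p (seen s (front s))
...   | true = refl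
...   | false = refl

reinsert-< : ∀ {q i} → suc i < q → reinsert q i ≡ suc i
reinsert-< {q} {i} h with suc i <ᵇ q | <⇒<ᵇ h
... | true | _ = refl

reinsert-≡ : ∀ {q i} → suc i ≡ q → reinsert q i ≡ 0
reinsert-≡ {q} {i} h with suc i <ᵇ q | <ᵇ⇒< (suc i) q
... | true | lt = ⊥-elim (<-irrefl h (lt tt))
... | false | _ with suc i ≡ᵇ q | ≡⇒≡ᵇ (suc i) q h
...   | true | _ = refl

reinsert-> : ∀ {q i} → q < suc i → reinsert q i ≡ i
reinsert-> {q} {i} h with suc i <ᵇ q | <ᵇ⇒< (suc i) q
... | true | lt = ⊥-elim (<-asym h (lt tt))
... | false | _ with suc i ≡ᵇ q | ≡ᵇ⇒≡ (suc i) q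
...   | true | eq = ⊥-elim (<-irrefl (sym (eq tt)) h)
...   | false | _ = refl

reinsert⁻¹-< : ∀ {q k} → suc k < q → reinsert⁻¹ q (suc k) ≡ k
reinsert⁻¹-< {q} {k} h with suc k <ᵇ q | <⇒<ᵇ h
... | true | _ = refl

reinsert⁻¹-≥ : ∀ {q k} → q ≤ suc k → reinsert⁻¹ q (suc k) ≡ suc k
reinsert⁻¹-≥ {q} {k} h with suc k <ᵇ q | <ᵇ⇒< (suc k) q
... | true | lt = ⊥-elim (<⇒≱ (lt tt) h)
... | false | _ = refl

reinsert-inverseˡ : ∀ q i → reinsert⁻¹ q (reinsert q i) ≡ i
reinsert-inverseˡ q i with <-cmp (suc i) q
... | tri< lt _ _ rewrite reinsert-< lt = reinsert⁻¹-< lt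
... | tri≈ _ eq _ rewrite reinsert-≡ eq = cong pred (sym eq)
... | tri> _ _ gt rewrite reinsert-> gt with i
...   | zero = cong pred (n<1⇒n≡0 gt)
...   | suc k = reinsert⁻¹-≥ (≤-pred gt)

reinsert-inverseʳ : ∀ q k → reinsert q (reinsert⁻¹ q k) ≡ k
reinsert-inverseʳ zero zero = reinsert-> z<s
reinsert-inverseʳ (suc r) zero = reinsert-≡ {i = r} refl
reinsert-inverseʳ q (suc k) with suc k <? q
... | yes lt rewrite reinsert⁻¹-< lt = reinsert-< lt
... | no ge rewrite reinsert⁻¹-≥ (≮⇒≥ ge) = reinsert-> (s≤s (≮⇒≥ ge))

reinsert-injective : ∀ q → Injective _≡_ _≡_ (reinsert q)
reinsert-injective q {i} {j} e =
  trans (sym (reinsert-inverseˡ q i)) (trans (cong (reinsert⁻¹ q) e) (reinsert-inverseˡ q j))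

reinsert-slot : ∀ {q j} → reinsert q j ≡ 0 → j ≡ pred q
reinsert-slot {q} {j} e = trans (sym (reinsert-inverseˡ q j)) (cong (reinsert⁻¹ q) e)

reinsert⁻¹-≤ : ∀ q k → reinsert⁻¹ q (suc k) ≤ suc k
reinsert⁻¹-≤ q k with suc k <? q
... | yes lt rewrite reinsert⁻¹-< lt = n≤1+n k
... | no ge rewrite reinsert⁻¹-≥ (≮⇒≥ ge) = ≤-refl

reinsert-<-reinsert : ∀ {q i j} → i < j → reinsert q i ≢ 0 → reinsert q j ≢ 0 →
                      reinsert q i < reinsert q j
reinsert-<-reinsert {q} {i} {j} i<j i≢0 j≢0 with <-cmp (suc j) q
... | tri≈ _ eq _ = ⊥-elim (j≢0 (reinsert-≡ eq))
... | tri< lt _ _ rewrite reinsert-< lt | reinsert-< (<-trans (s<s i<j) lt) = s<s i<j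
... | tri> _ _ gt rewrite reinsert-> gt with <-cmp (suc i) q
...   | tri< lt _ _ rewrite reinsert-< lt = <-≤-trans lt (≤-pred gt)
...   | tri≈ _ eq _ = ⊥-elim (i≢0 (reinsert-≡ eq))
...   | tri> _ _ gt′ rewrite reinsert-> gt′ = i<j

m<pred[n]⇒suc[m]<n : ∀ {m n} → m < pred n → suc m < n
m<pred[n]⇒suc[m]<n {n = suc n} h = s<s h

seen-step-front : ∀ p s {x} → x ≡ front (step p s) → seen (step p s) x ≡ suc (seen s x)
seen-step-front p s {x} e with x ≡ᵇ front (step p s) | ≡⇒≡ᵇ x _ e
... | true | _ = refl

seen-step-other : ∀ p s {x} → x ≢ front (step p s) → seen (step p s) x ≡ seen s x
seen-step-other p s {x} ne with x ≡ᵇ front (step p s) | ≡ᵇ⇒≡ x (front (step p s))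
... | true | eq = ⊥-elim (ne (eq tt))
... | false | _ = refl

step-injective : ∀ p s → Injective _≡_ _≡_ (deck s) → Injective _≡_ _≡_ (deck (step p s))
step-injective p s inj {i} {j} e =
  reinsert-injective (p (seen s (front s))) (inj (trans (sym (deck-step p s i)) (trans e (deck-step p s j))))

deck-injective : ∀ p m → Injective _≡_ _≡_ (deck (stateAt p m))
deck-injective p zero = suc-injective
deck-injective p (suc m) = step-injective p (stateAt p m) (deck-injective p m)

deck-positive : ∀ p m i → 1 ≤ deck (stateAt p m) i
deck-positive p zero i = s≤s z≤n
deck-positive p (suc m) i =
  subst (1 ≤_) (sym (deck-step p (stateAt p m) i)) (deck-positive p m _)

seen-front-positive : ∀ p m → 1 ≤ seen (stateAt p m) (front (stateAt p m))
seen-front-positive p zero = ≤-refl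
seen-front-positive p (suc m) =
  subst (1 ≤_) (sym (seen-step-front p (stateAt p m) refl)) (s≤s z≤n)

record CardOneLeads (p : ℕ → ℕ) (s : State) : Set where
  field
    most-seen : ∀ x → seen s x ≤ seen s 1
    ahead-fewer : ∀ {i j} → deck s j ≡ 1 → 0 < i → i < j → seen s (deck s i) < seen s 1
    front-fewer : front s ≡ 1 → ∀ {i} → 0 < i → seen s (deck s i) < seen s 1
    card-one-position : Σ ℕ λ j → deck s j ≡ 1 × suc j ≤ p (seen s 1)

module CardOneLeadsStep (p : ℕ → ℕ) (p-pos : ∀ k → 1 ≤ k → 1 ≤ p k)
                        (s : State) (inj : Injective _≡_ _≡_ (deck s)) (L : CardOneLeads p s) where
  open CardOneLeads L

  s′ = step p s
  k₁ = seen s 1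
  q = p (seen s (front s))

  deck′ : ∀ i → deck s′ i ≡ deck s (reinsert q i)
  deck′ = deck-step p s

  not-front : ∀ {i} → 0 < i → deck s′ i ≢ front s′
  not-front 0<i e = <⇒≢ 0<i (sym (step-injective p s inj e))

  seen-unchanged : ∀ {i} → 0 < i → seen s′ (deck s′ i) ≡ seen s (deck s′ i)
  seen-unchanged 0<i = seen-step-other p s (not-front 0<i)

  module AtFront (e : front s′ ≡ 1) where
    seen′-one : seen s′ 1 ≡ suc k₁
    seen′-one = seen-step-front p s (sym e)

    leads : CardOneLeads p s′
    leads = record
      { most-seen = most-seen′
      ; ahead-fewer = λ {i} at-j 0<i i<j → ⊥-elim (not-front (<-trans 0<i i<j) (trans at-j (sym e)))
      ; front-fewer = λ _ 0<i → subst₂ _<_ (sym (seen-unchanged 0<i)) (sym seen′-one) (s≤s (most-seen _))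
      ; card-one-position = 0 , e , subst (λ k → 1 ≤ p k) (sym seen′-one) (p-pos (suc k₁) (s≤s z≤n))
      }
      where
      most-seen′ : ∀ x → seen s′ x ≤ seen s′ 1
      most-seen′ x with x ≟ 1
      ... | yes refl = ≤-refl
      ... | no x≢1 = subst₂ _≤_ (sym (seen-step-other p s (λ x≡f → x≢1 (trans x≡f e)))) (sym seen′-one)
                       (m≤n⇒m≤1+n (most-seen x))

  module Behind (ne : front s′ ≢ 1) where
    seen′-one : seen s′ 1 ≡ k₁
    seen′-one = seen-step-other p s (λ 1≡f → ne (sym 1≡f))

    front-fewer-if-overtaken : ∀ {j₁} → suc j₁ ≤ p k₁ → pred q < j₁ → seen s (front s) < k₁
    front-fewer-if-overtaken reach overtaken = ≤∧≢⇒< (most-seen (front s)) λ k≡k₁ →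
      <-irrefl refl (<-≤-trans overtaken (subst (λ k → _ ≤ pred (p k)) (sym k≡k₁) (<⇒≤pred reach)))

    ahead-fewer′ : ∀ j₁ → deck s j₁ ≡ 1 → suc j₁ ≤ p k₁ →
                   ∀ {i} → i < reinsert⁻¹ q j₁ → seen s (deck s′ i) < k₁
    ahead-fewer′ zero at-front _ {i} i<j′ rewrite deck′ i | reinsert-< {q} (m<pred[n]⇒suc[m]<n i<j′) =
      front-fewer at-front z<s
    ahead-fewer′ (suc j) at-j₁ reach {i} i<j′ rewrite deck′ i with reinsert q i ≟ 0
    ... | yes slot rewrite slot =
      front-fewer-if-overtaken reach
        (subst (_< suc j) (reinsert-slot {q} slot) (<-≤-trans i<j′ (reinsert⁻¹-≤ q j)))
    ... | no not-slot = ahead-fewer at-j₁ (n≢0⇒n>0 not-slot)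
      (subst (reinsert q i <_) (reinsert-inverseʳ q (suc j))
        (reinsert-<-reinsert {q} i<j′ not-slot (λ e → 0≢1+n (trans (sym e) (reinsert-inverseʳ q (suc j))))))

    new-position-reach : ∀ j₁ → deck s j₁ ≡ 1 → suc j₁ ≤ p k₁ → suc (reinsert⁻¹ q j₁) ≤ p k₁
    new-position-reach zero at-front reach rewrite at-front = m≤pred[n]⇒suc[m]≤n {{>-nonZero reach}} ≤-refl
    new-position-reach (suc j) _ reach = ≤-trans (s≤s (reinsert⁻¹-≤ q j)) reach

    j₁ = proj₁ card-one-position
    at-j₁ = proj₁ (proj₂ card-one-position)
    reach = proj₂ (proj₂ card-one-position)
    j′ = reinsert⁻¹ q j₁

    at-j′ : deck s′ j′ ≡ 1
    at-j′ = trans (deck′ j′) (trans (cong (deck s) (reinsert-inverseʳ q j₁)) at-j₁)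

    0<j′ : 0 < j′
    0<j′ = n≢0⇒n>0 λ j′≡0 → ne (subst (λ i → deck s′ i ≡ 1) j′≡0 at-j′)

    leads : CardOneLeads p s′
    leads = record
      { most-seen = most-seen′
      ; ahead-fewer = λ {i} at-j 0<i i<j → subst₂ _<_ (sym (seen-unchanged 0<i)) (sym seen′-one)
          (ahead-fewer′ j₁ at-j₁ reach (subst (i <_) (step-injective p s inj (trans at-j (sym at-j′))) i<j))
      ; front-fewer = λ e → ⊥-elim (ne e)
      ; card-one-position = j′ , at-j′ ,
          subst (λ k → suc j′ ≤ p k) (sym seen′-one) (new-position-reach j₁ at-j₁ reach)
      }
      where
      most-seen′ : ∀ x → seen s′ x ≤ seen s′ 1
      most-seen′ x with x ≟ front s′
      ... | yes refl = subst₂ _≤_ (sym (seen-step-front p s refl)) (sym seen′-one)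
                         (ahead-fewer′ j₁ at-j₁ reach 0<j′)
      ... | no x≢f = subst₂ _≤_ (sym (seen-step-other p s x≢f)) (sym seen′-one) (most-seen x)

  leads : CardOneLeads p s′
  leads with front s′ ≟ 1
  ... | yes e = AtFront.leads e
  ... | no ne = Behind.leads ne

card-one-leads : ∀ p → (∀ k → 1 ≤ k → 1 ≤ p k) → ∀ m → CardOneLeads p (stateAt p m)
card-one-leads p p-pos zero = record
  { most-seen = initial-most-seen
  ; ahead-fewer = λ at-j 0<i i<j → ⊥-elim (<⇒≢ (<-trans 0<i i<j) (sym (suc-injective at-j)))
  ; front-fewer = λ { _ {suc i} _ → z<s }
  ; card-one-position = 0 , refl , p-pos 1 ≤-refl
  }
  where
  initial-most-seen : ∀ x → seen initial x ≤ 1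
  initial-most-seen x with x ≡ᵇ 1
  ... | true = ≤-refl
  ... | false = z≤n
card-one-leads p p-pos (suc m) =
  CardOneLeadsStep.leads p p-pos (stateAt p m) (deck-injective p m) (card-one-leads p p-pos m)

FixedFrom : ℕ → State → Set
FixedFrom P s = ∀ i → P ≤ i → deck s i ≡ suc i

fixedFrom-step : ∀ p s {P} → p (seen s (front s)) ≤ P → FixedFrom P s → FixedFrom P (step p s)
fixedFrom-step p s q≤P fixed i P≤i =
  trans (deck-step p s i) (trans (cong (deck s) (reinsert-> (s≤s (≤-trans q≤P P≤i)))) (fixed i P≤i))

front-≤ : ∀ s {P} → Injective _≡_ _≡_ (deck s) → FixedFrom P s → 1 ≤ P → front s ≤ P
front-≤ s {P} inj fixed 1≤P with deck s 0 in eq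
... | zero = z≤n
... | suc m with suc m ≤? P
...   | yes le = le
...   | no gt = ⊥-elim (1+n≰n (≤-trans 1≤P (subst (P ≤_) m≡0 P≤m)))
  where
  P≤m : P ≤ m
  P≤m = ≤-pred (≰⇒> gt)
  m≡0 : m ≡ 0
  m≡0 = inj (trans (fixed m P≤m) (sym eq))

sumTo : (ℕ → ℕ) → ℕ → ℕ
sumTo f zero = 0
sumTo f (suc m) = f (suc m) + sumTo f m

sumTo-cong : ∀ {f g} m → (∀ x → x ≤ m → f x ≡ g x) → sumTo f m ≡ sumTo g m
sumTo-cong zero _ = refl
sumTo-cong (suc m) f≗g = cong₂ _+_ (f≗g (suc m) ≤-refl) (sumTo-cong m λ x x≤m → f≗g x (m≤n⇒m≤1+n x≤m))

sumTo-suc-at : ∀ {f g} a m → 1 ≤ a → a ≤ m → g a ≡ suc (f a) → (∀ x → x ≢ a → g x ≡ f x) →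
               sumTo g m ≡ suc (sumTo f m)
sumTo-suc-at a zero 1≤a a≤0 _ _ with () ← ≤-trans 1≤a a≤0
sumTo-suc-at {f} {g} a (suc m) 1≤a a≤m ga others with a ≟ suc m
... | yes refl = cong₂ _+_ ga (sumTo-cong m λ x x≤m → others x (<⇒≢ (s≤s x≤m)))
... | no a≢ = trans (cong₂ _+_ (others (suc m) (≢-sym a≢))
                              (sumTo-suc-at a m 1≤a (≤-pred (≤∧≢⇒< a≤m a≢)) ga others))
                    (+-suc (f (suc m)) (sumTo f m))

sumTo-≤ : ∀ {f} B m → (∀ x → f x ≤ B) → sumTo f m ≤ m * B
sumTo-≤ B zero _ = z≤n
sumTo-≤ B (suc m) f≤B = +-mono-≤ (f≤B (suc m)) (sumTo-≤ B m f≤B)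

seen-total-initial : ∀ P → 1 ≤ P → sumTo (seen initial) P ≡ 1
seen-total-initial (suc zero) _ = refl
seen-total-initial (suc (suc P)) _ = seen-total-initial (suc P) (s≤s z≤n)

seen-total-step : ∀ p s {P} → Injective _≡_ _≡_ (deck (step p s)) → (∀ i → 1 ≤ deck (step p s) i) →
                  FixedFrom P (step p s) → 1 ≤ P → sumTo (seen (step p s)) P ≡ suc (sumTo (seen s) P)
seen-total-step p s {P} inj pos fixed 1≤P =
  sumTo-suc-at (front (step p s)) P (pos 0) (front-≤ (step p s) inj fixed 1≤P)
    (seen-step-front p s refl) (λ x → seen-step-other p s)

seen-step-increase : ∀ p s {x} → seen s x < seen (step p s) x →
                     x ≡ front (step p s) × seen (step p s) x ≡ suc (seen s x)
seen-step-increase p s {x} increased with x ≟ front (step p s)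
... | yes e = e , seen-step-front p s e
... | no ne = ⊥-elim (<-irrefl (sym (seen-step-other p s ne)) increased)

module Counting (p : ℕ → ℕ) (p-pos : ∀ k → 1 ≤ k → 1 ≤ p k)
                (p-mono : ∀ k l → 1 ≤ k → k ≤ l → p k ≤ p l) (n : ℕ) (1≤n : 1 ≤ n) where
  P = p n

  Reached : ℕ → Set
  Reached m = Σ ℕ λ t → IsT p 1 (suc n) t × t ≤ suc m

  -- stateAt p m is the state at time m + 1, so m + 1 views have been made.
  Pending : ℕ → Set
  Pending m = seen (stateAt p m) 1 ≤ n × FixedFrom P (stateAt p m) × sumTo (seen (stateAt p m)) P ≡ suc m

  pending-step : ∀ m → Pending m → seen (stateAt p (suc m)) 1 ≤ n → Pending (suc m)
  pending-step m (seen₁≤n , fixed , total) seen₁′≤n = seen₁′≤n , fixed′ ,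
    trans (seen-total-step p s (deck-injective p (suc m)) (deck-positive p (suc m)) fixed′ (p-pos n 1≤n))
          (cong suc total)
    where
    s = stateAt p m
    fixed′ = fixedFrom-step p s (p-mono _ n (seen-front-positive p m)
               (≤-trans (CardOneLeads.most-seen (card-one-leads p p-pos m) (front s)) seen₁≤n)) fixed

  reached-or-pending : ∀ m → Reached m ⊎ Pending m
  reached-or-pending zero = inj₂ (1≤n , (λ _ _ → refl) , seen-total-initial P (p-pos n 1≤n))
  reached-or-pending (suc m) with reached-or-pending m
  ... | inj₁ (t , is-t , t≤) = inj₁ (t , is-t , m≤n⇒m≤1+n t≤)
  ... | inj₂ pending@(seen₁≤n , _) with seen (stateAt p (suc m)) 1 ≤? n
  ...   | yes seen₁′≤n = inj₂ (pending-step m pending seen₁′≤n)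
  ...   | no seen₁′≰n = inj₁ (suc (suc m) , (sym at-front , trans increment (cong suc seen₁≡n)) , ≤-refl)
    where
    increase = seen-step-increase p (stateAt p m) (<-≤-trans (s≤s seen₁≤n) (≰⇒> seen₁′≰n))
    at-front = proj₁ increase
    increment = proj₂ increase
    seen₁≡n = ≤-antisym seen₁≤n (≤-pred (subst (n <_) increment (≰⇒> seen₁′≰n)))

  pending-bounded : ∀ m → Pending m → suc m ≤ n * P
  pending-bounded m (seen₁≤n , _ , total) = subst₂ _≤_ total (*-comm P n)
    (sumTo-≤ n P λ x → ≤-trans (CardOneLeads.most-seen (card-one-leads p p-pos m) x) seen₁≤n)

mainTheorem12 : (p : ℕ → ℕ)
    → (∀ k → 1 ≤ k → 1 ≤ p k)
    → (∀ k l → 1 ≤ k → k ≤ l → p k ≤ p l)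
    → (∀ M → Σ ℕ λ k → 1 ≤ k × M < p k)
    → ∀ n → 1 ≤ n
    → Σ ℕ λ t → IsT p 1 (suc n) t × t ≤ 1 + n * p n
mainTheorem12 p p-pos p-mono _ n 1≤n =
  fromInj₁ (λ pending → ⊥-elim (1+n≰n (pending-bounded (n * p n) pending)))
           (reached-or-pending (n * p n))
  where open Counting p p-pos p-mono n 1≤n
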